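{- Let $T$ be a tree with vertex set $[n]$, $n\ge 2$, let $p=p^{(3)}_T$ be its Steiner $3$-form, and let $a_3,\ldots,a_n\in\mathbb{C}$ be arbitrary. Set $A = d_T(1,2)$, $B = \sum_{j\ge 3}\big(d_T(1,2)-d_T(1,j)+d_T(2,j)\big)a_j$, and $C = \sum_{j,k\ge 3}\big(d_T(2,j) - \tfrac12 d_T(j,k)\big)a_ja_k$. Let $a_1$ be any solution of $Aa_1^2 + Ba_1 + C = 0$ and let $a_2 = -a_1 - \sum_{j=3}^n a_j$. Then $(a_1,\ldots,a_n)$ is a Steiner nullvector, i.e. $\frac{\partial p}{\partial x_r}(a_1,\ldots,a_n) = 0$ for all $r\in[n]$.
   Context: For a graph $G$ and a set $S \subseteq V(G)$, the Steiner distance $d_G(S)$ (written $d_G(v_1,\ldots,v_m)$ for $S=\{v_1,\ldots,v_m\}$, repetitions allowed) is the minimum number of edges in a connected subgraph of $G$ containing all of $S$; in particular $d_G(\{v\})=0$, and $d_G(i,j)$ is the ordinary graph distance. The Steiner $3$-form of $T$ is $p^{(3)}_T(x)=\sum_{v_1,v_2,v_3\in[n]} d_T(v_1,v_2,v_3)\,x_{v_1}x_{v_2}x_{v_3}$. -}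

module Defs where

open import Level using (Level; _⊔_) renaming (suc to lsuc; zero to lzero)
open import Data.Nat as ℕ using (ℕ; zero; suc)
open import Data.Fin using (Fin; toℕ) renaming (zero to fzero; suc to fsuc)
open import Data.List using (List; []; _∷_; length)
open import Data.List.Relation.Unary.All using (All)
open import Data.List.Relation.Unary.Unique.Propositional using (Unique)
open import Data.List.Membership.Propositional using (_∈_)
open import Data.Product using (Σ; _×_; _,_; ∃)
open import Data.Sum using (_⊎_)
open import Relation.Binary.PropositionalEquality using (_≡_)
open import Relation.Nullary using (¬_)
open import Algebra.Bundles using (CommutativeRing)

-- Finite simple graphs on the vertex set Fin n  (vertex i ↔ i+1 ∈ [n])

record Graph (n : ℕ) : Set₁ where
  field
    Adj    : Fin n → Fin n → Set
    sym    : ∀ {i j} → Adj i j → Adj j i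
    irrefl : ∀ {i} → ¬ Adj i i
open Graph public

data Walk {n : ℕ} (G : Graph n) : Fin n → Fin n → Set where
  here : ∀ {u} → Walk G u u
  step : ∀ {u w v} → Adj G u w → Walk G w v → Walk G u v

Connected : ∀ {n} → Graph n → Set
Connected G = ∀ u v → Walk G u v

Chain : ∀ {n} → Graph n → List (Fin n) → Set
Chain G []           = Data.Unit.⊤ where import Data.Unit
Chain G (u ∷ [])     = Data.Unit.⊤ where import Data.Unit
Chain G (u ∷ w ∷ vs) = Adj G u w × Chain G (w ∷ vs)

lastOf : ∀ {A : Set} → A → List A → A
lastOf x []       = x
lastOf x (y ∷ ys) = lastOf y ys

IsCycle : ∀ {n} → Graph n → List (Fin n) → Set
IsCycle G []           = Data.Empty.⊥ where import Data.Empty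
IsCycle G (v₀ ∷ vs) =
  (3 ℕ.≤ length (v₀ ∷ vs)) × Unique (v₀ ∷ vs) × Chain G (v₀ ∷ vs)
  × Adj G (lastOf v₀ vs) v₀

Acyclic : ∀ {n} → Graph n → Set
Acyclic G = ∀ cs → ¬ IsCycle G cs

IsTree : ∀ {n} → Graph n → Set
IsTree G = Connected G × Acyclic G

-- an edge {i,j} of a subgraph is stored once, as (i , j) with i < j
Edge : ℕ → Set
Edge n = Fin n × Fin n

data EdgeIn {n : ℕ} : List (Edge n) → Fin n → Fin n → Set where
  fwd : ∀ {Es i j} → (i , j) ∈ Es → EdgeIn Es i j
  bwd : ∀ {Es i j} → (j , i) ∈ Es → EdgeIn Es i j

data SubWalk {n : ℕ} (Es : List (Edge n)) : Fin n → Fin n → Set where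
  here : ∀ {u} → SubWalk Es u u
  step : ∀ {u w v} → EdgeIn Es u w → SubWalk Es w v → SubWalk Es u v

record ConnSubgraph {n : ℕ} (G : Graph n) : Set₁ where
  field
    Vs        : Fin n → Set
    Es        : List (Edge n)
    es-unique : Unique Es
    es-edges  : All (λ e → Adj G (Data.Product.proj₁ e) (Data.Product.proj₂ e)
                         × (toℕ (Data.Product.proj₁ e) ℕ.< toℕ (Data.Product.proj₂ e))
                         × Vs (Data.Product.proj₁ e) × Vs (Data.Product.proj₂ e)) Es
    connected : ∀ u v → Vs u → Vs v → SubWalk Es u v
open ConnSubgraph public

numEdges : ∀ {n} {G : Graph n} → ConnSubgraph G → ℕ
numEdges H = length (Es H)

Contains : ∀ {n} {G : Graph n} → ConnSubgraph G → List (Fin n) → Set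
Contains H S = All (Vs H) S

-- d_G(S) = k : k is the minimum number of edges of a connected subgraph
-- of G containing all vertices of S (S given as a list; repetitions allowed)
IsSteinerDist : ∀ {n} → Graph n → List (Fin n) → ℕ → Set₁
IsSteinerDist G S k =
  (Σ (ConnSubgraph G) λ H → Contains H S × numEdges H ≡ k)
  × (∀ (H : ConnSubgraph G) → Contains H S → k ℕ.≤ numEdges H)

module RingDefs {c ℓ} (R : CommutativeRing c ℓ) where
  open CommutativeRing R

  fromℕ : ℕ → Carrier
  fromℕ zero    = 0#
  fromℕ (suc m) = 1# + fromℕ m

  sumFin : ∀ {n} → (Fin n → Carrier) → Carrier
  sumFin {zero}  f = 0#
  sumFin {suc n} f = f fzero + sumFin (λ i → f (fsuc i))

  IsField : Set (c ⊔ ℓ)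
  IsField = (¬ (1# ≈ 0#)) × (∀ x → ¬ (x ≈ 0#) → ∃ λ y → x * y ≈ 1#)

  CharZero : Set ℓ
  CharZero = ∀ m → ¬ (fromℕ (suc m) ≈ 0#)

  -- ∂/∂x_r of  Σ_{v₁ v₂ v₃} d(v₁,v₂,v₃) x_{v₁} x_{v₂} x_{v₃}, evaluated at x
  -- (product rule, written out term by term)
  partialCubic : ∀ {n} → (Fin n → Fin n → Fin n → ℕ) → (Fin n → Carrier)
               → Fin n → Carrier
  partialCubic d x r =
      sumFin (λ v₂ → sumFin (λ v₃ → fromℕ (d r v₂ v₃) * (x v₂ * x v₃)))
    + (sumFin (λ v₁ → sumFin (λ v₃ → fromℕ (d v₁ r v₃) * (x v₁ * x v₃)))
    + sumFin (λ v₁ → sumFin (λ v₂ → fromℕ (d v₁ v₂ r) * (x v₁ * x v₂))))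

{-# OPTIONS --safe #-}
-- Removing an edge of a tree splits its vertices into two sides. A connected subgraph containing S
-- must use every edge that separates S, and a smallest one uses no other edge (else keep only its
-- part on the side holding S). So d(S) counts the edges separating S, and counting edge by edge gives
-- 2 d(x,y,z) = d(x,y) + d(y,z) + d(x,z). In 2 ∂p/∂x_r(a) this identity leaves, besides terms with a
-- single index that vanish because Σ a = 0, three copies of the distance form Σ d(v,w) a_v a_w; after
-- substituting a₂ = -(a₁ + Σ_{j≥3} a_j) the distance form is minus the quadratic in a₁, hence zero.
module Submission where

open import Defs
open import Data.Nat using (ℕ; suc)
import Data.Nat as N
open import Data.Fin using (Fin) renaming (zero to fzero; suc to fsuc)
open import Data.List using (_∷_; [])
open import Algebra.Bundles using (CommutativeRing)

open import Data.Nat using (zero; _≤_; _<_; s≤s; z≤n)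
open import Data.Nat.Properties using (<-asym; <-irrefl; ≤-<-trans; *-distribˡ-+; *-zeroʳ)
open import Algebra.Properties.CommutativeSemigroup Data.Nat.Properties.+-commutativeSemigroup using ()
  renaming (interchange to +-interchange; xy∙z≈xz∙y to +-xy∙z≈xz∙y; xy∙z≈zx∙y to +-xy∙z≈zx∙y)
import Data.Fin as F
open import Data.Fin using (toℕ)
open import Data.List using (List; _++_; length; filter)
open import Data.List.Properties using (++-assoc; filter-notAll; ∷-injectiveˡ)
open import Data.List.Relation.Unary.All as All using (All; []; _∷_)
import Data.List.Relation.Unary.All.Properties as All
open import Data.List.Relation.Unary.Any as Any using (here; there)
open import Data.List.Relation.Unary.AllPairs using ([]; _∷_)
open import Data.List.Relation.Unary.Unique.Propositional using (Unique)
import Data.List.Relation.Unary.Unique.Propositional.Properties as Unique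
open import Data.List.Membership.Propositional using (_∈_; _∉_)
open import Data.List.Membership.Propositional.Properties using (∈-∃++; ∈-filter⁺)
open import Data.Product using (_×_; _,_; proj₁; proj₂; swap)
open import Data.Product.Properties using (≡-dec)
open import Data.Sum as Sum using (_⊎_; inj₁; inj₂)
open import Data.Empty using (⊥-elim)
open import Data.Unit using (tt)
open import Data.Bool using (Bool; true; false; if_then_else_; _xor_; _∨_)
import Data.Bool as Bool
open import Relation.Binary.PropositionalEquality as ≡ using (_≡_; _≢_; refl; cong; cong₂; subst)
open import Relation.Binary.Definitions using (DecidableEquality)
open import Relation.Nullary using (¬_; Dec; yes; no; does)
open import Relation.Nullary.Decidable using (dec-true; dec-false; does-⇔; _×-dec_)
open import Function.Bundles using (mk⇔)
open import Relation.Unary using (Decidable)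

module _ {A : Set} where

  lastOf-++ : ∀ (x : A) xs y ys → lastOf x (xs ++ y ∷ ys) ≡ lastOf y ys
  lastOf-++ x []       y ys = refl
  lastOf-++ x (z ∷ xs) y ys = lastOf-++ z xs y ys

  lastOf-split : ∀ (x : A) xs ys y zs → x ∷ xs ≡ ys ++ y ∷ zs → lastOf x xs ≡ lastOf y zs
  lastOf-split x xs []       y zs refl = refl
  lastOf-split x xs (w ∷ ys) y zs refl = lastOf-++ w ys y zs

  lastOf-∈ : ∀ (x : A) xs → lastOf x xs ∈ x ∷ xs
  lastOf-∈ x []       = here refl
  lastOf-∈ x (y ∷ xs) = there (lastOf-∈ y xs)

  Unique-++⁻ˡ : ∀ xs {ys : List A} → Unique (xs ++ ys) → Unique xs
  Unique-++⁻ˡ []       _        = []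
  Unique-++⁻ˡ (x ∷ xs) (px ∷ u) = All.++⁻ˡ xs px ∷ Unique-++⁻ˡ xs u

  Unique-++⁻ʳ : ∀ xs {ys : List A} → Unique (xs ++ ys) → Unique ys
  Unique-++⁻ʳ []       u       = u
  Unique-++⁻ʳ (x ∷ xs) (_ ∷ u) = Unique-++⁻ʳ xs u

  ∉⇒All≢ : ∀ {x : A} {xs} → x ∉ xs → All (x ≢_) xs
  ∉⇒All≢ = All.¬Any⇒All¬ _

  All≢⇒∉ : ∀ {x : A} {xs} → All (x ≢_) xs → x ∉ xs
  All≢⇒∉ = All.All¬⇒¬Any

module _ {n : ℕ} (G : Graph n) where

  Chain-tail : ∀ x xs → Chain G (x ∷ xs) → Chain G xs
  Chain-tail x []      _       = tt
  Chain-tail x (_ ∷ _) (_ , c) = c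

  Chain-++⁻ˡ : ∀ xs ys → Chain G (xs ++ ys) → Chain G xs
  Chain-++⁻ˡ []           ys _       = tt
  Chain-++⁻ˡ (x ∷ [])     ys _       = tt
  Chain-++⁻ˡ (x ∷ y ∷ xs) ys (a , c) = a , Chain-++⁻ˡ (y ∷ xs) ys c

  Chain-++⁻ʳ : ∀ xs ys → Chain G (xs ++ ys) → Chain G ys
  Chain-++⁻ʳ []       ys c = c
  Chain-++⁻ʳ (x ∷ xs) ys c = Chain-++⁻ʳ xs ys (Chain-tail x (xs ++ ys) c)

  record SimplePath (u v : Fin n) : Set where
    constructor simplePath
    field
      rest    : List (Fin n)
      chain   : Chain G (u ∷ rest)
      unique  : Unique (u ∷ rest)
      lastOf≡ : lastOf u rest ≡ v
  open SimplePath public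

  SimplePath-suffix : ∀ {u v w} (P : SimplePath u v) ys zs → u ∷ rest P ≡ ys ++ w ∷ zs → SimplePath w v
  SimplePath-suffix {u} (simplePath r ch un la) ys zs eq = simplePath zs
    (Chain-++⁻ʳ ys (_ ∷ zs) (subst (Chain G) eq ch))
    (Unique-++⁻ʳ ys (subst Unique eq un))
    (≡.trans (≡.sym (lastOf-split u r ys _ zs eq)) la)

  walk⇒simplePath : ∀ {u v} → Walk G u v → SimplePath u v
  walk⇒simplePath here = simplePath [] tt ([] ∷ []) refl
  walk⇒simplePath (step {u} {w} uw W) with walk⇒simplePath W
  ... | P@(simplePath r ch un la) with Any.any? (u F.≟_) (w ∷ r)
  ... | yes u∈ = let ys , zs , eq = ∈-∃++ u∈ in SimplePath-suffix P ys zs eq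
  ... | no  u∉ = simplePath (w ∷ r) (uw , ch) (∉⇒All≢ u∉ ∷ un) la

module _ {n : ℕ} {G : Graph n} (acyclic : Acyclic G) where

  -- Otherwise a, the c-branch up to c', and c' would close a cycle; the recursion walks along the c'-branch.
  branch-ends-differ : ∀ (a c c' : Fin n) p q → Adj G a c → Adj G a c' → c ≢ c'
    → a ∉ c ∷ p → a ∉ c' ∷ q → Chain G (c ∷ p) → Chain G (c' ∷ q)
    → Unique (c ∷ p) → Unique (c' ∷ q) → lastOf c p ≢ lastOf c' q
  branch-ends-differ a c c' p q ac ac' c≢c' a∉p a∉q chp chq up uq ends
    with Any.any? (c' F.≟_) (c ∷ p)
  ... | yes c'∈ with ∈-∃++ c'∈
  ... | [] , _ , refl = c≢c' refl
  ... | h ∷ ys , zs , refl = acyclic (a ∷ c ∷ ys ++ c' ∷ []) (long ys , distinct , path , closing)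
    where
    cycle-prefix : (c ∷ ys ++ c' ∷ []) ++ zs ≡ c ∷ p
    cycle-prefix = cong (c ∷_) (++-assoc ys (c' ∷ []) zs)
    long : ∀ xs → 3 ≤ length (a ∷ c ∷ xs ++ c' ∷ [])
    long []      = s≤s (s≤s (s≤s z≤n))
    long (_ ∷ _) = s≤s (s≤s (s≤s z≤n))
    distinct : Unique (a ∷ c ∷ ys ++ c' ∷ [])
    distinct = All.++⁻ˡ (c ∷ ys ++ c' ∷ []) (subst (All (a ≢_)) (≡.sym cycle-prefix) (∉⇒All≢ a∉p))
             ∷ Unique-++⁻ˡ (c ∷ ys ++ c' ∷ []) (subst Unique (≡.sym cycle-prefix) up)
    path : Chain G (a ∷ c ∷ ys ++ c' ∷ [])
    path = ac , Chain-++⁻ˡ G (c ∷ ys ++ c' ∷ []) zs (subst (Chain G) (≡.sym cycle-prefix) chp)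
    closing : Adj G (lastOf c (ys ++ c' ∷ [])) a
    closing = subst (λ t → Adj G t a) (≡.sym (lastOf-++ c ys c' [])) (sym G ac')
  branch-ends-differ a c c' p [] ac ac' c≢c' a∉p a∉q chp chq up uq ends | no c'∉ =
    c'∉ (subst (_∈ c ∷ p) ends (lastOf-∈ c p))
  branch-ends-differ a c c' p (c'' ∷ q) ac ac' c≢c' a∉p a∉q chp (c'c'' , chq) up (c'∉q ∷ uq) ends | no c'∉ =
    branch-ends-differ c' a c'' (c ∷ p) q (sym G ac') c'c'' (λ a≡c'' → a∉q (there (here a≡c'')))
      (λ { (here c'≡a) → a∉q (here (≡.sym c'≡a)) ; (there c'∈) → c'∉ c'∈ })
      (All≢⇒∉ c'∉q) (ac , chp) chq (∉⇒All≢ a∉p ∷ up) uq ends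

  simplePath-rest-unique : ∀ (a : Fin n) p q → Chain G (a ∷ p) → Chain G (a ∷ q)
    → Unique (a ∷ p) → Unique (a ∷ q) → lastOf a p ≡ lastOf a q → p ≡ q
  simplePath-rest-unique a []      []       _ _ _ _ _ = refl
  simplePath-rest-unique a []      (c ∷ q)  _ _ _ (a∉q ∷ _) ends =
    ⊥-elim (All≢⇒∉ a∉q (subst (_∈ c ∷ q) (≡.sym ends) (lastOf-∈ c q)))
  simplePath-rest-unique a (c ∷ p) []       _ _ (a∉p ∷ _) _ ends =
    ⊥-elim (All≢⇒∉ a∉p (subst (_∈ c ∷ p) ends (lastOf-∈ c p)))
  simplePath-rest-unique a (c ∷ p) (c' ∷ q) (ac , chp) (ac' , chq) (a∉p ∷ up) (a∉q ∷ uq) ends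
    with c F.≟ c'
  ... | yes refl = cong (c ∷_) (simplePath-rest-unique c p q chp chq up uq ends)
  ... | no  c≢c' = ⊥-elim (branch-ends-differ a c c' p q ac ac' c≢c'
                             (All≢⇒∉ a∉p) (All≢⇒∉ a∉q) chp chq up uq ends)

  simplePath-unique : ∀ {u v} (P Q : SimplePath G u v) → rest P ≡ rest Q
  simplePath-unique {u} (simplePath p chp up lp) (simplePath q chq uq lq) =
    simplePath-rest-unique u p q chp chq up uq (≡.trans lp (≡.sym lq))

module EdgeSide {n : ℕ} (T : Graph n) (tree : IsTree T) (x y : Fin n) where

  pathTo : ∀ z → SimplePath T z y
  pathTo z = walk⇒simplePath T (proj₁ tree z y)

  route : Fin n → List (Fin n)
  route z = rest (pathTo z)

  route-unique : ∀ {z} (P : SimplePath T z y) → route z ≡ rest P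
  route-unique P = simplePath-unique (proj₂ tree) (pathTo _) P

  -- For an edge xy, side is true exactly on the component of x in T − xy.
  side : Fin n → Bool
  side z = does (Any.any? (x F.≟_) (z ∷ route z))

  route-step : ∀ {z z'} → Adj T z z' → route z ≡ z' ∷ route z' ⊎ route z' ≡ z ∷ route z
  route-step {z} {z'} zz' = by-cases (pathTo z) refl
    where
    by-cases : (P : SimplePath T z y) → route z ≡ rest P → route z ≡ z' ∷ route z' ⊎ route z' ≡ z ∷ route z
    by-cases P@(simplePath r ch un la) route≡r with Any.any? (z' F.≟_) (z ∷ r)
    ... | no z'∉ = inj₂ (≡.trans (route-unique (simplePath (z ∷ r) (sym T zz' , ch) (∉⇒All≢ z'∉ ∷ un) la))
                                 (cong (z ∷_) (≡.sym route≡r)))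
    ... | yes z'∈ with ∈-∃++ z'∈
    ... | [] , _ , refl = ⊥-elim (irrefl T zz')
    ... | _ ∷ ys , zs , refl = inj₁ (≡.trans (route-unique (simplePath (z' ∷ zs) (zz' , chain Q) (z∉ un ∷ unique Q) (lastOf≡ Q)))
                                            (cong (z' ∷_) (≡.sym (route-unique Q))))
      where
      Q : SimplePath T z' y
      Q = SimplePath-suffix T P (z ∷ ys) zs refl
      z∉ : Unique (z ∷ ys ++ z' ∷ zs) → All (z ≢_) (z' ∷ zs)
      z∉ (z∉r ∷ _) = All.++⁻ʳ ys z∉r

  module _ (xy : Adj T x y) where

    route-x : route x ≡ y ∷ []
    route-x = route-unique (simplePath (y ∷ []) (xy , tt) ((x≢y ∷ []) ∷ [] ∷ []) refl)
      where
      x≢y : x ≢ y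
      x≢y refl = irrefl T xy

    route-y : route y ≡ []
    route-y = route-unique (simplePath [] tt ([] ∷ []) refl)

    side-x : side x ≡ true
    side-x = dec-true (Any.any? (x F.≟_) (x ∷ route x)) (here refl)

    side-y : side y ≡ false
    side-y = dec-false (Any.any? (x F.≟_) (y ∷ route y)) (x∉ (route y) route-y)
      where
      x∉ : ∀ r → r ≡ [] → x ∉ y ∷ r
      x∉ _ refl (here refl) = irrefl T xy

    side-along-route : ∀ {z z'} → route z ≡ z' ∷ route z' → x ≢ z → side z ≡ side z'
    side-along-route {z} {z'} route≡ x≢z =
      does-⇔ (mk⇔ to from) (Any.any? (x F.≟_) (z ∷ route z)) (Any.any? (x F.≟_) (z' ∷ route z'))
      where
      to : x ∈ z ∷ route z → x ∈ z' ∷ route z'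
      to (here x≡z) = ⊥-elim (x≢z x≡z)
      to (there x∈) = subst (x ∈_) route≡ x∈
      from : x ∈ z' ∷ route z' → x ∈ z ∷ route z
      from x∈ = there (subst (x ∈_) (≡.sym route≡) x∈)

    side-change-along-route : ∀ {z z'} → route z ≡ z' ∷ route z' → side z ≢ side z' → z ≡ x × z' ≡ y
    side-change-along-route {z} {z'} route≡ sides≢ = by-cases (x F.≟ z)
      where
      by-cases : Dec (x ≡ z) → z ≡ x × z' ≡ y
      by-cases (yes x≡z) = ≡.sym x≡z , ∷-injectiveˡ (≡.trans (≡.sym route≡) (subst (λ t → route t ≡ y ∷ []) x≡z route-x))
      by-cases (no  x≢z) = ⊥-elim (sides≢ (side-along-route route≡ x≢z))

    side-change : ∀ {z z'} → Adj T z z' → side z ≢ side z' → (z ≡ x × z' ≡ y) ⊎ (z ≡ y × z' ≡ x)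
    side-change zz' sides≢ with route-step zz'
    ... | inj₁ route≡ = inj₁ (side-change-along-route route≡ sides≢)
    ... | inj₂ route≡ = inj₂ (swap (side-change-along-route route≡ (λ e → sides≢ (≡.sym e))))

module _ {n : ℕ} {G : Graph n} (H : ConnSubgraph G) where

  ∈Es⇒Adj×ordered : ∀ {a w} → (a , w) ∈ Es H → Adj G a w × toℕ a < toℕ w
  ∈Es⇒Adj×ordered a,w∈ with All.lookup (es-edges H) a,w∈
  ... | aw , a<w , _ = aw , a<w

  EdgeIn⇒Adj : ∀ {a w} → EdgeIn (Es H) a w → Adj G a w
  EdgeIn⇒Adj (fwd a,w∈) = proj₁ (∈Es⇒Adj×ordered a,w∈)
  EdgeIn⇒Adj (bwd w,a∈) = sym G (proj₁ (∈Es⇒Adj×ordered w,a∈))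

module EdgeCut {n : ℕ} (T : Graph n) (tree : IsTree T) {i j : Fin n} (ij : Adj T i j) (i<j : toℕ i < toℕ j) where

  open EdgeSide T tree i j

  crossing-edge∈ : (H : ConnSubgraph T) → ∀ {a b} → SubWalk (Es H) a b → side a ≢ side b → (i , j) ∈ Es H
  crossing-edge∈ H here sides≢ = ⊥-elim (sides≢ refl)
  crossing-edge∈ H (step {a} {w} aw W) sides≢ with side a Bool.≟ side w
  ... | yes a~w = crossing-edge∈ H W (λ e → sides≢ (≡.trans a~w e))
  ... | no  a≁w with side-change ij (EdgeIn⇒Adj H aw) a≁w | aw
  ... | inj₁ (refl , refl) | fwd i,j∈ = i,j∈
  ... | inj₁ (refl , refl) | bwd j,i∈ = ⊥-elim (<-asym i<j (proj₂ (∈Es⇒Adj×ordered H j,i∈)))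
  ... | inj₂ (refl , refl) | fwd j,i∈ = ⊥-elim (<-asym i<j (proj₂ (∈Es⇒Adj×ordered H j,i∈)))
  ... | inj₂ (refl , refl) | bwd i,j∈ = i,j∈

  endpointOn : Bool → Fin n
  endpointOn s = if s then i else j

  endpointOn-side : ∀ s {b c} → (b ≡ i × c ≡ j) ⊎ (b ≡ j × c ≡ i) → side b ≡ s → b ≡ endpointOn s
  endpointOn-side true  (inj₁ (refl , _)) _ = refl
  endpointOn-side false (inj₁ (refl , _)) e with ≡.trans (≡.sym (side-x ij)) e
  ... | ()
  endpointOn-side true  (inj₂ (refl , _)) e with ≡.trans (≡.sym (side-y ij)) e
  ... | ()
  endpointOn-side false (inj₂ (refl , _)) _ = refl

  module OnSide (H : ConnSubgraph T) (s : Bool) where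

    OnSide? : Decidable (λ (e : Edge n) → side (proj₁ e) ≡ s × side (proj₂ e) ≡ s)
    OnSide? (a , w) = (side a Bool.≟ s) ×-dec (side w Bool.≟ s)

    Es-onSide : List (Edge n)
    Es-onSide = filter OnSide? (Es H)

    EdgeIn-onSide : ∀ {a w} → EdgeIn (Es H) a w → side a ≡ s → side w ≡ s → EdgeIn Es-onSide a w
    EdgeIn-onSide (fwd a,w∈) sa sw = fwd (∈-filter⁺ OnSide? a,w∈ (sa , sw))
    EdgeIn-onSide (bwd w,a∈) sa sw = bwd (∈-filter⁺ OnSide? w,a∈ (sw , sa))

    -- Cut the walk at its last crossing of ij: what follows stays on side s and starts at endpointOn s.
    restrict-walk : ∀ {a q} → SubWalk (Es H) a q → side q ≡ s
      → (side a ≡ s → SubWalk Es-onSide a q) × (side a ≢ s → SubWalk Es-onSide (endpointOn s) q)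
    restrict-walk here sq = (λ _ → here) , (λ a≁s → ⊥-elim (a≁s sq))
    restrict-walk {q = q} (step {a} {w} aw W) sq with restrict-walk W sq | side w Bool.≟ s
    ... | from-w , _ | yes sw =
          (λ sa → step (EdgeIn-onSide aw sa sw) (from-w sw))
        , (λ a≁s → subst (λ t → SubWalk Es-onSide t q)
                     (endpointOn-side s (Sum.swap (Sum.map swap swap (side-change ij (EdgeIn⇒Adj H aw) (λ e → a≁s (≡.trans e sw))))) sw)
                     (from-w sw))
    ... | _ , from-endpoint | no w≁s =
          (λ sa → subst (λ t → SubWalk Es-onSide t q)
                    (≡.sym (endpointOn-side s (side-change ij (EdgeIn⇒Adj H aw) (λ e → w≁s (≡.trans (≡.sym e) sa))) sa))
                    (from-endpoint w≁s))
        , (λ _ → from-endpoint w≁s)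

    onSide : ConnSubgraph T
    onSide = record
      { Vs        = λ z → Vs H z × side z ≡ s
      ; Es        = Es-onSide
      ; es-unique = Unique.filter⁺ OnSide? (es-unique H)
      ; es-edges  = All.zipWith (λ { ((aw , a<w , va , vw) , (sa , sw)) → aw , a<w , (va , sa) , (vw , sw) })
                      (All.filter⁺ OnSide? (es-edges H) , All.all-filter OnSide? (Es H))
      ; connected = λ u v (vu , su) (vv , sv) → proj₁ (restrict-walk (connected H u v vu vv) sv) su
      }

    onSide-shorter : (i , j) ∈ Es H → numEdges onSide < numEdges H
    onSide-shorter i,j∈ = filter-notAll OnSide? (Es H) (Any.map (λ { refl (si , sj) → sides≢ (≡.trans si (≡.sym sj)) }) i,j∈)
      where
      sides≢ : side i ≢ side j
      sides≢ e with ≡.trans (≡.sym (side-x ij)) (≡.trans e (side-y ij))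
      ... | ()

  optimal-edge⇒¬one-sided : ∀ {S k} (sd : IsSteinerDist T S k) → (i , j) ∈ Es (proj₁ (proj₁ sd))
                           → ∀ s → ¬ All (λ v → side v ≡ s) S
  optimal-edge⇒¬one-sided {k = k} ((H , H⊇S , |H|≡k) , minimal) i,j∈ s one-sided =
    <-irrefl refl (subst (k <_) |H|≡k (≤-<-trans (minimal onSide (All.zip (H⊇S , one-sided))) (onSide-shorter i,j∈)))
    where open OnSide H s

indicator : Bool → ℕ
indicator b = if b then 1 else 0

module Counting {A : Set} (_≟_ : DecidableEquality A) where

  sumOver : List A → (A → ℕ) → ℕ
  sumOver []       f = 0
  sumOver (x ∷ xs) f = f x N.+ sumOver xs f

  sumOver-cong : ∀ xs {f g : A → ℕ} → (∀ {x} → x ∈ xs → f x ≡ g x) → sumOver xs f ≡ sumOver xs g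
  sumOver-cong []       f≗g = refl
  sumOver-cong (x ∷ xs) f≗g = cong₂ N._+_ (f≗g (here refl)) (sumOver-cong xs (λ x∈ → f≗g (there x∈)))

  sumOver-zero : ∀ xs → sumOver xs (λ _ → 0) ≡ 0
  sumOver-zero []       = refl
  sumOver-zero (x ∷ xs) = sumOver-zero xs

  sumOver-+ : ∀ xs (f g : A → ℕ) → sumOver xs (λ x → f x N.+ g x) ≡ sumOver xs f N.+ sumOver xs g
  sumOver-+ []       f g = refl
  sumOver-+ (x ∷ xs) f g rewrite sumOver-+ xs f g = +-interchange (f x) (g x) (sumOver xs f) (sumOver xs g)

  sumOver-*ˡ : ∀ c xs (f : A → ℕ) → sumOver xs (λ x → c N.* f x) ≡ c N.* sumOver xs f
  sumOver-*ˡ c []       f = ≡.sym (*-zeroʳ c)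
  sumOver-*ˡ c (x ∷ xs) f rewrite sumOver-*ˡ c xs f = ≡.sym (*-distribˡ-+ c (f x) (sumOver xs f))

  multiplicity : List A → A → ℕ
  multiplicity ys x = sumOver ys (λ y → indicator (does (x ≟ y)))

  multiplicity-∉ : ∀ ys {x} → x ∉ ys → multiplicity ys x ≡ 0
  multiplicity-∉ ys {x} x∉ =
    ≡.trans (sumOver-cong ys (λ y∈ → cong indicator (dec-false (x ≟ _) (λ { refl → x∉ y∈ })))) (sumOver-zero ys)

  multiplicity-∈ : ∀ {ys x} → Unique ys → x ∈ ys → multiplicity ys x ≡ 1
  multiplicity-∈ {y ∷ ys} (y∉ ∷ _)  (here refl) =
    cong₂ N._+_ (cong indicator (dec-true (y ≟ y) refl)) (multiplicity-∉ ys (All≢⇒∉ y∉))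
  multiplicity-∈ {y ∷ ys} (y∉ ∷ uq) (there x∈) =
    cong₂ N._+_ (cong indicator (dec-false (_ ≟ y) (λ { refl → All≢⇒∉ y∉ x∈ }))) (multiplicity-∈ uq x∈)

  length≡sumOver-multiplicity : ∀ xs ys → Unique ys → (∀ {x} → x ∈ xs → x ∈ ys)
                              → length xs ≡ sumOver ys (multiplicity xs)
  length≡sumOver-multiplicity []       ys uq xs⊆ys = ≡.sym (sumOver-zero ys)
  length≡sumOver-multiplicity (x ∷ xs) ys uq xs⊆ys = begin
    1 N.+ length xs
      ≡⟨ cong₂ N._+_ (≡.sym (multiplicity-∈ uq (xs⊆ys (here refl))))
                     (length≡sumOver-multiplicity xs ys uq (λ x∈ → xs⊆ys (there x∈))) ⟩
    multiplicity ys x N.+ sumOver ys (multiplicity xs)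
      ≡⟨ cong (N._+ _) (sumOver-cong ys (λ _ → cong indicator (does-⇔ (mk⇔ ≡.sym ≡.sym) (x ≟ _) (_ ≟ x)))) ⟩
    sumOver ys (λ y → indicator (does (y ≟ x))) N.+ sumOver ys (multiplicity xs)
      ≡⟨ ≡.sym (sumOver-+ ys _ (multiplicity xs)) ⟩
    sumOver ys (multiplicity (x ∷ xs)) ∎
    where open ≡.≡-Reasoning

separated : Bool → Bool → Bool → Bool
separated a b c = (a xor b) ∨ (a xor c)

separated-true : ∀ a b c → separated a b c ≡ true → a ≢ b ⊎ a ≢ c
separated-true true  false _     _ = inj₁ (λ ())
separated-true false true  _     _ = inj₁ (λ ())
separated-true true  true  false _ = inj₂ (λ ())
separated-true false false true  _ = inj₂ (λ ())

separated-false : ∀ a b c → separated a b c ≡ false → b ≡ a × c ≡ a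
separated-false true  true  true  _ = refl , refl
separated-false false false false _ = refl , refl

separated-swap : ∀ a b → separated a b b ≡ separated b a a
separated-swap true  true  = refl
separated-swap true  false = refl
separated-swap false true  = refl
separated-swap false false = refl

indicator-separated : ∀ a b c
  → 2 N.* indicator (separated a b c) ≡ indicator (separated a b b) N.+ indicator (separated b c c) N.+ indicator (separated a c c)
indicator-separated true  true  true  = refl
indicator-separated true  true  false = refl
indicator-separated true  false true  = refl
indicator-separated true  false false = refl
indicator-separated false true  true  = refl
indicator-separated false true  false = refl
indicator-separated false false true  = refl
indicator-separated false false false = refl

module SteinerInTree {n : ℕ} (T : Graph n) (tree : IsTree T)
  (d : Fin n → Fin n → Fin n → ℕ) (steiner : ∀ u v w → IsSteinerDist T (u ∷ v ∷ w ∷ []) (d u v w)) where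

  open Counting (≡-dec (F._≟_ {n}) (F._≟_ {n}))

  TreeEdge : Edge n → Set
  TreeEdge (a , w) = Adj T a w × toℕ a < toℕ w

  side : Edge n → Fin n → Bool
  side (a , w) = EdgeSide.side T tree a w

  separatedBy : Edge n → Fin n → Fin n → Fin n → Bool
  separatedBy e u v w = separated (side e u) (side e v) (side e w)

  optimal : Fin n → Fin n → Fin n → ConnSubgraph T
  optimal u v w = proj₁ (proj₁ (steiner u v w))

  optimal-contains : ∀ u v w → Contains (optimal u v w) (u ∷ v ∷ w ∷ [])
  optimal-contains u v w = proj₁ (proj₂ (proj₁ (steiner u v w)))

  optimal-treeEdge : ∀ {u v w e} → e ∈ Es (optimal u v w) → TreeEdge e
  optimal-treeEdge {u} {v} {w} {_ , _} = ∈Es⇒Adj×ordered (optimal u v w)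

  separated⇒edge∈ : ∀ (H : ConnSubgraph T) {u v w e} → Contains H (u ∷ v ∷ w ∷ []) → TreeEdge e
                  → separatedBy e u v w ≡ true → e ∈ Es H
  separated⇒edge∈ H {u} {v} {w} {e} (hu ∷ hv ∷ hw ∷ []) (ij , i<j) sep
    with separated-true (side e u) (side e v) (side e w) sep
  ... | inj₁ u≁v = EdgeCut.crossing-edge∈ T tree ij i<j H (connected H u v hu hv) u≁v
  ... | inj₂ u≁w = EdgeCut.crossing-edge∈ T tree ij i<j H (connected H u w hu hw) u≁w

  edge∈optimal⇒separated : ∀ {u v w e} → e ∈ Es (optimal u v w) → separatedBy e u v w ≡ true
  edge∈optimal⇒separated {u} {v} {w} {e} e∈ with separatedBy e u v w in sep
  ... | true  = refl
  ... | false with optimal-treeEdge e∈ | separated-false (side e u) (side e v) (side e w) sep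
  ... | ij , i<j | v~u , w~u =
    ⊥-elim (EdgeCut.optimal-edge⇒¬one-sided T tree ij i<j (steiner u v w) e∈ (side e u) (refl ∷ v~u ∷ w~u ∷ []))

  steinerDist≡count : ∀ u v w (U : List (Edge n)) → Unique U → All TreeEdge U
    → (∀ {e} → e ∈ Es (optimal u v w) → e ∈ U) → d u v w ≡ sumOver U (λ e → indicator (separatedBy e u v w))
  steinerDist≡count u v w U uq treeEdges optimal⊆U = begin
    d u v w                                            ≡⟨ ≡.sym (proj₂ (proj₂ (proj₁ (steiner u v w)))) ⟩
    length (Es (optimal u v w))                        ≡⟨ length≡sumOver-multiplicity _ U uq optimal⊆U ⟩
    sumOver U (multiplicity (Es (optimal u v w)))      ≡⟨ sumOver-cong U multiplicity≡ ⟩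
    sumOver U (λ e → indicator (separatedBy e u v w))  ∎
    where
    open ≡.≡-Reasoning
    multiplicity≡ : ∀ {e} → e ∈ U → multiplicity (Es (optimal u v w)) e ≡ indicator (separatedBy e u v w)
    multiplicity≡ {e} e∈U with separatedBy e u v w in sep
    ... | true  = multiplicity-∈ {x = e} (es-unique (optimal u v w))
                    (separated⇒edge∈ (optimal u v w) (optimal-contains u v w) (All.lookup treeEdges e∈U) sep)
    ... | false = multiplicity-∉ (Es (optimal u v w)) {e} (λ e∈ → true≢false (≡.trans (≡.sym (edge∈optimal⇒separated e∈)) sep))
      where
      true≢false : true ≢ false
      true≢false ()

  optimal-pair⊆ : ∀ {x y e} (H : ConnSubgraph T) → Vs H x → Vs H y → e ∈ Es (optimal x y y) → e ∈ Es H
  optimal-pair⊆ H hx hy e∈ = separated⇒edge∈ H (hx ∷ hy ∷ hy ∷ []) (optimal-treeEdge e∈) (edge∈optimal⇒separated e∈)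

  optimal-treeEdges : ∀ u v w → All TreeEdge (Es (optimal u v w))
  optimal-treeEdges u v w = All.tabulate (optimal-treeEdge {u} {v} {w})

  steinerDist-diagonal : ∀ x → d x x x ≡ 0
  steinerDist-diagonal x = steinerDist≡count x x x [] [] [] (λ {e} e∈ → ⊥-elim (unseparated (side e x) (edge∈optimal⇒separated e∈)))
    where
    unseparated : ∀ a → separated a a a ≢ true
    unseparated a sep = Sum.[ (λ a≢a → a≢a refl) , (λ a≢a → a≢a refl) ]′ (separated-true a a a sep)

  pairDist-sym : ∀ x y → d x y y ≡ d y x x
  pairDist-sym x y with optimal-contains x y y
  ... | hx ∷ hy ∷ _ = begin
    d x y y                                            ≡⟨ steinerDist≡count x y y U (es-unique H) (optimal-treeEdges x y y) (λ e∈ → e∈) ⟩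
    sumOver U (λ e → indicator (separatedBy e x y y))  ≡⟨ sumOver-cong U (λ {e} _ → cong indicator (separated-swap (side e x) (side e y))) ⟩
    sumOver U (λ e → indicator (separatedBy e y x x))  ≡⟨ ≡.sym (steinerDist≡count y x x U (es-unique H) (optimal-treeEdges x y y) (optimal-pair⊆ H hy hx)) ⟩
    d y x x                                            ∎
    where
    open ≡.≡-Reasoning
    H : ConnSubgraph T
    H = optimal x y y
    U : List (Edge n)
    U = Es H

  steinerDist-halfPerimeter : ∀ x y z → 2 N.* d x y z ≡ d x y y N.+ d y z z N.+ d x z z
  steinerDist-halfPerimeter x y z with optimal-contains x y z
  ... | hx ∷ hy ∷ hz ∷ [] = begin
    2 N.* d x y z                               ≡⟨ cong (2 N.*_) (count x y z (λ e∈ → e∈)) ⟩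
    2 N.* sumOver U [x,y,z]                      ≡⟨ ≡.sym (sumOver-*ˡ 2 U [x,y,z]) ⟩
    sumOver U (λ e → 2 N.* [x,y,z] e)            ≡⟨ sumOver-cong U (λ {e} _ → indicator-separated (side e x) (side e y) (side e z)) ⟩
    sumOver U (λ e → [x,y] e N.+ [y,z] e N.+ [x,z] e)
      ≡⟨ ≡.trans (sumOver-+ U (λ e → [x,y] e N.+ [y,z] e) [x,z]) (cong (N._+ sumOver U [x,z]) (sumOver-+ U [x,y] [y,z])) ⟩
    sumOver U [x,y] N.+ sumOver U [y,z] N.+ sumOver U [x,z]
      ≡⟨ ≡.sym (cong₂ N._+_ (cong₂ N._+_ (count x y y (optimal-pair⊆ H hx hy)) (count y z z (optimal-pair⊆ H hy hz)))
                            (count x z z (optimal-pair⊆ H hx hz))) ⟩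
    d x y y N.+ d y z z N.+ d x z z              ∎
    where
    open ≡.≡-Reasoning
    H : ConnSubgraph T
    H = optimal x y z
    U : List (Edge n)
    U = Es H
    [x,y,z] [x,y] [y,z] [x,z] : Edge n → ℕ
    [x,y,z] e = indicator (separatedBy e x y z)
    [x,y]   e = indicator (separatedBy e x y y)
    [y,z]   e = indicator (separatedBy e y z z)
    [x,z]   e = indicator (separatedBy e x z z)
    count : ∀ u v w → (∀ {e} → e ∈ Es (optimal u v w) → e ∈ U) → d u v w ≡ sumOver U (λ e → indicator (separatedBy e u v w))
    count u v w = steinerDist≡count u v w U (es-unique H) (optimal-treeEdges x y z)

module FieldArithmetic {c ℓ} (K : CommutativeRing c ℓ) where

  open CommutativeRing K renaming (refl to ≈-refl; sym to ≈-sym; trans to ≈-trans)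
  open RingDefs K
  open import Algebra.Properties.CommutativeSemigroup +-commutativeSemigroup using (interchange)
  open import Algebra.Properties.Ring ring using (-‿+-comm; -0#≈0#)
  open import Relation.Binary.Reasoning.Setoid setoid

  fromℕ-+ : ∀ p q → fromℕ (p N.+ q) ≈ fromℕ p + fromℕ q
  fromℕ-+ zero    q = ≈-sym (+-identityˡ _)
  fromℕ-+ (suc p) q = ≈-trans (+-congˡ (fromℕ-+ p q)) (≈-sym (+-assoc _ _ _))

  fromℕ-* : ∀ p q → fromℕ (p N.* q) ≈ fromℕ p * fromℕ q
  fromℕ-* zero    q = ≈-sym (zeroˡ _)
  fromℕ-* (suc p) q = begin
    fromℕ (q N.+ p N.* q)           ≈⟨ ≈-trans (fromℕ-+ q (p N.* q)) (+-congˡ (fromℕ-* p q)) ⟩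
    fromℕ q + fromℕ p * fromℕ q     ≈⟨ +-congʳ (≈-sym (*-identityˡ _)) ⟩
    1# * fromℕ q + fromℕ p * fromℕ q ≈⟨ distribʳ _ _ _ ⟨
    (1# + fromℕ p) * fromℕ q        ∎

  fromℕ-cong : ∀ {p q} → p ≡ q → fromℕ p ≈ fromℕ q
  fromℕ-cong p≡q = reflexive (cong fromℕ p≡q)

  sumFin-cong : ∀ {k} {f g : Fin k → Carrier} → (∀ i → f i ≈ g i) → sumFin f ≈ sumFin g
  sumFin-cong {zero}  f≈g = ≈-refl
  sumFin-cong {suc k} f≈g = +-cong (f≈g fzero) (sumFin-cong (λ i → f≈g (fsuc i)))

  sumFin-+ : ∀ {k} (f g : Fin k → Carrier) → sumFin (λ i → f i + g i) ≈ sumFin f + sumFin g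
  sumFin-+ {zero}  f g = ≈-sym (+-identityˡ 0#)
  sumFin-+ {suc k} f g = ≈-trans (+-congˡ (sumFin-+ (λ i → f (fsuc i)) (λ i → g (fsuc i)))) (interchange _ _ _ _)

  sumFin-*ˡ : ∀ {k} x (f : Fin k → Carrier) → sumFin (λ i → x * f i) ≈ x * sumFin f
  sumFin-*ˡ {zero}  x f = ≈-sym (zeroʳ x)
  sumFin-*ˡ {suc k} x f = ≈-trans (+-congˡ (sumFin-*ˡ x (λ i → f (fsuc i)))) (≈-sym (distribˡ x _ _))

  sumFin-*ʳ : ∀ {k} x (f : Fin k → Carrier) → sumFin (λ i → f i * x) ≈ sumFin f * x
  sumFin-*ʳ x f = ≈-trans (sumFin-cong (λ i → *-comm (f i) x)) (≈-trans (sumFin-*ˡ x f) (*-comm x _))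

  sumFin-neg : ∀ {k} (f : Fin k → Carrier) → sumFin (λ i → - f i) ≈ - sumFin f
  sumFin-neg {zero}  f = ≈-sym -0#≈0#
  sumFin-neg {suc k} f = ≈-trans (+-congˡ (sumFin-neg (λ i → f (fsuc i)))) (-‿+-comm _ _)

  *-cancelˡ-nonzero : IsField → ∀ {x y} → ¬ x ≈ 0# → x * y ≈ 0# → y ≈ 0#
  *-cancelˡ-nonzero (_ , inverse) {x} {y} x≉0 xy≈0 with inverse x x≉0
  ... | x⁻¹ , xx⁻¹≈1 = begin
    y                ≈⟨ *-identityˡ y ⟨
    1# * y           ≈⟨ *-congʳ xx⁻¹≈1 ⟨
    (x * x⁻¹) * y    ≈⟨ *-congʳ (*-comm x x⁻¹) ⟩
    (x⁻¹ * x) * y    ≈⟨ *-assoc x⁻¹ x y ⟩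
    x⁻¹ * (x * y)    ≈⟨ *-congˡ xy≈0 ⟩
    x⁻¹ * 0#         ≈⟨ zeroʳ x⁻¹ ⟩
    0#               ∎

module QuadraticForms {c ℓ} (K : CommutativeRing c ℓ) where

  open CommutativeRing K renaming (refl to ≈-refl; sym to ≈-sym; trans to ≈-trans)
  open RingDefs K
  open FieldArithmetic K
  open import Algebra.Solver.Ring.NaturalCoefficients.Default commutativeSemiring using (solve; _:+_; _:*_; _:=_)
  open import Relation.Binary.Reasoning.Setoid setoid

  quadraticForm : ∀ {n} → (Fin n → Fin n → ℕ) → (Fin n → Carrier) → Carrier
  quadraticForm D a = sumFin (λ v → sumFin (λ w → fromℕ (D v w) * (a v * a w)))

  module _ {n} (D : Fin n → Fin n → ℕ) (a : Fin n → Carrier) (Σa≈0 : sumFin a ≈ 0#) where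

    -- The parts α v and β w of 2c depend on one index only, so Σ a = 0 kills them.
    doubled-quadraticForm : ∀ (c : Fin n → Fin n → ℕ) (α β : Fin n → ℕ)
      → (∀ v w → 2 N.* c v w ≡ α v N.+ D v w N.+ β w) → fromℕ 2 * quadraticForm c a ≈ quadraticForm D a
    doubled-quadraticForm c α β 2c≡ = begin
      fromℕ 2 * quadraticForm c a                   ≈⟨ sumFin-*ˡ (fromℕ 2) (row c) ⟨
      sumFin (λ v → fromℕ 2 * row c v)              ≈⟨ sumFin-cong doubled-row ⟩
      sumFin (λ v → row D v + a v * Σβa)            ≈⟨ sumFin-+ (row D) (λ v → a v * Σβa) ⟩
      quadraticForm D a + sumFin (λ v → a v * Σβa)  ≈⟨ +-congˡ (≈-trans (sumFin-*ʳ Σβa a) (*-congʳ Σa≈0)) ⟩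
      quadraticForm D a + 0# * Σβa                  ≈⟨ +-congˡ (zeroˡ Σβa) ⟩
      quadraticForm D a + 0#                        ≈⟨ +-identityʳ _ ⟩
      quadraticForm D a                             ∎
      where
      term : (Fin n → Fin n → ℕ) → Fin n → Fin n → Carrier
      term e v w = fromℕ (e v w) * (a v * a w)
      row : (Fin n → Fin n → ℕ) → Fin n → Carrier
      row e v = sumFin (term e v)
      αa βa : Fin n → Fin n → Carrier
      αa v w = (fromℕ (α v) * a v) * a w
      βa v w = a v * (fromℕ (β w) * a w)
      Σβa : Carrier
      Σβa = sumFin (λ w → fromℕ (β w) * a w)
      doubled-term : ∀ v w → fromℕ 2 * term c v w ≈ αa v w + (term D v w + βa v w)
      doubled-term v w = begin
        fromℕ 2 * (fromℕ (c v w) * (a v * a w))                ≈⟨ *-assoc _ _ _ ⟨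
        (fromℕ 2 * fromℕ (c v w)) * (a v * a w)                ≈⟨ *-congʳ (fromℕ-* 2 (c v w)) ⟨
        fromℕ (2 N.* c v w) * (a v * a w)                      ≈⟨ *-congʳ (fromℕ-cong (2c≡ v w)) ⟩
        fromℕ (α v N.+ D v w N.+ β w) * (a v * a w)            ≈⟨ *-congʳ (≈-trans (fromℕ-+ (α v N.+ D v w) (β w)) (+-congʳ (fromℕ-+ (α v) (D v w)))) ⟩
        (fromℕ (α v) + fromℕ (D v w) + fromℕ (β w)) * (a v * a w)
          ≈⟨ solve 5 (λ p q r x y → (p :+ q :+ r) :* (x :* y) := (p :* x) :* y :+ (q :* (x :* y) :+ x :* (r :* y)))
                   ≈-refl (fromℕ (α v)) (fromℕ (D v w)) (fromℕ (β w)) (a v) (a w) ⟩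
        αa v w + (term D v w + βa v w)                          ∎
      doubled-row : ∀ v → fromℕ 2 * row c v ≈ row D v + a v * Σβa
      doubled-row v = begin
        fromℕ 2 * row c v                                         ≈⟨ sumFin-*ˡ (fromℕ 2) (term c v) ⟨
        sumFin (λ w → fromℕ 2 * term c v w)                       ≈⟨ sumFin-cong (doubled-term v) ⟩
        sumFin (λ w → αa v w + (term D v w + βa v w))
          ≈⟨ ≈-trans (sumFin-+ (αa v) (λ w → term D v w + βa v w)) (+-congˡ (sumFin-+ (term D v) (βa v))) ⟩
        sumFin (αa v) + (row D v + sumFin (βa v))
          ≈⟨ +-cong (≈-trans (sumFin-*ˡ (fromℕ (α v) * a v) a) (*-congˡ Σa≈0)) (+-congˡ (sumFin-*ˡ (a v) (λ w → fromℕ (β w) * a w))) ⟩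
        (fromℕ (α v) * a v) * 0# + (row D v + a v * Σβa)          ≈⟨ ≈-trans (+-congʳ (zeroʳ _)) (+-identityˡ _) ⟩
        row D v + a v * Σβa                                       ∎

  partialCubic-doubled : ∀ {n} (d : Fin n → Fin n → Fin n → ℕ) (a : Fin n → Carrier) → sumFin a ≈ 0#
    → (∀ x y z → 2 N.* d x y z ≡ d x y y N.+ d y z z N.+ d x z z)
    → ∀ r → let Q = quadraticForm (λ v w → d v w w) a in fromℕ 2 * partialCubic d a r ≈ Q + (Q + Q)
  partialCubic-doubled {n} d a Σa≈0 halfPerimeter r = begin
    fromℕ 2 * (quadraticForm c₁ a + (quadraticForm c₂ a + quadraticForm c₃ a))
      ≈⟨ ≈-trans (distribˡ (fromℕ 2) (quadraticForm c₁ a) _) (+-congˡ (distribˡ (fromℕ 2) (quadraticForm c₂ a) _)) ⟩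
    fromℕ 2 * quadraticForm c₁ a + (fromℕ 2 * quadraticForm c₂ a + fromℕ 2 * quadraticForm c₃ a)
      ≈⟨ +-cong (doubled c₁ (D r) (D r) (halfPerimeter r))
                (+-cong (doubled c₂ (λ v → D v r) (D r) (λ v w → ≡.trans (halfPerimeter v r w) (+-xy∙z≈xz∙y (D v r) _ _)))
                        (doubled c₃ (λ v → D v r) (λ w → D w r) (λ v w → ≡.trans (halfPerimeter v w r) (+-xy∙z≈zx∙y (D v w) _ _)))) ⟩
    Q + (Q + Q) ∎
    where
    D : Fin n → Fin n → ℕ
    D v w = d v w w
    Q : Carrier
    Q = quadraticForm D a
    c₁ c₂ c₃ : Fin n → Fin n → ℕ
    c₁ v w = d r v w
    c₂ v w = d v r w
    c₃ v w = d v w r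
    doubled : ∀ c α β → (∀ v w → 2 N.* c v w ≡ α v N.+ D v w N.+ β w) → fromℕ 2 * quadraticForm c a ≈ Q
    doubled = doubled-quadraticForm D a Σa≈0

module SplitAtFirstTwoVertices {c ℓ} (K : CommutativeRing c ℓ) {m : ℕ}
  (d : Fin (suc (suc m)) → Fin (suc (suc m)) → Fin (suc (suc m)) → ℕ)
  (pairDist-sym : ∀ x y → d x y y ≡ d y x x) (diagonal : ∀ x → d x x x ≡ 0)
  (a : Fin (suc (suc m)) → CommutativeRing.Carrier K) where

  open CommutativeRing K renaming (refl to ≈-refl; sym to ≈-sym; trans to ≈-trans)
  open RingDefs K
  open FieldArithmetic K
  open QuadraticForms K
  open import Algebra.Properties.Ring ring using (-‿distribˡ-*)
  open import Algebra.Solver.Ring.NaturalCoefficients.Default commutativeSemiring using (solve; _:+_; _:*_; _:=_; con)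
  open import Relation.Binary.Reasoning.Setoid setoid

  v₁ v₂ : Fin (suc (suc m))
  v₁ = fzero
  v₂ = fsuc fzero

  J : Fin m → Fin (suc (suc m))
  J j = fsuc (fsuc j)

  dist : Fin (suc (suc m)) → Fin (suc (suc m)) → ℕ
  dist u v = d u v v

  two A S Y : Carrier
  two = fromℕ 2
  A = fromℕ (dist v₁ v₂)
  S = sumFin (λ j → a (J j))
  Y = sumFin (λ j → sumFin (λ k → fromℕ (dist (J j) (J k)) * (a (J j) * a (J k))))

  X : Fin (suc (suc m)) → Carrier
  X u = sumFin (λ k → fromℕ (dist u (J k)) * a (J k))

  B C₂ quadratic : Carrier
  B = sumFin (λ j → (fromℕ (dist v₁ v₂ N.+ dist v₂ (J j)) - fromℕ (dist v₁ (J j))) * a (J j))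
  C₂ = sumFin (λ j → sumFin (λ k →
         (fromℕ (2 N.* dist v₂ (J j)) - fromℕ (dist (J j) (J k))) * (a (J j) * a (J k))))
  quadratic = fromℕ 2 * (A * (a v₁ * a v₁)) + fromℕ 2 * (B * a v₁) + C₂

  row-J : ∀ u → sumFin (λ k → fromℕ (dist u (J k)) * (a u * a (J k))) ≈ a u * X u
  row-J u = ≈-trans (sumFin-cong (λ k → solve 3 (λ c x y → c :* (x :* y) := x :* (c :* y)) ≈-refl _ (a u) (a (J k))))
                    (sumFin-*ˡ (a u) (λ k → fromℕ (dist u (J k)) * a (J k)))

  column-J : ∀ u → sumFin (λ j → fromℕ (dist (J j) u) * (a (J j) * a u)) ≈ a u * X u
  column-J u = ≈-trans (sumFin-cong (λ j → ≈-trans (*-congʳ (fromℕ-cong (pairDist-sym (J j) u)))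
                                                   (solve 3 (λ c x y → c :* (x :* y) := y :* (c :* x)) ≈-refl _ (a (J j)) (a u))))
                       (sumFin-*ˡ (a u) (λ k → fromℕ (dist u (J k)) * a (J k)))

  distanceForm-split : quadraticForm dist a ≈ two * (A * (a v₁ * a v₂)) + two * (a v₁ * X v₁) + two * (a v₂ * X v₂) + Y
  -- The constant t is spelled out so that it evaluates to fromℕ 2 = 1# + (1# + 0#) on the nose.
  distanceForm-split = begin
    quadraticForm dist a
      ≈⟨ +-cong (+-cong (*-congʳ (fromℕ-cong (diagonal v₁))) (+-congˡ (row-J v₁)))
                (+-cong (+-cong (*-congʳ (fromℕ-cong (pairDist-sym v₂ v₁))) (+-cong (*-congʳ (fromℕ-cong (diagonal v₂))) (row-J v₂)))
                        (≈-trans (sumFin-+ (λ j → fromℕ (dist (J j) v₁) * (a (J j) * a v₁)) _)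
                                 (+-cong (column-J v₁) (≈-trans (sumFin-+ (λ j → fromℕ (dist (J j) v₂) * (a (J j) * a v₂)) _)
                                                                (+-congʳ (column-J v₂)))))) ⟩
    (0# * (a v₁ * a v₁) + (A * (a v₁ * a v₂) + a v₁ * X v₁))
      + ((A * (a v₂ * a v₁) + (0# * (a v₂ * a v₂) + a v₂ * X v₂)) + (a v₁ * X v₁ + (a v₂ * X v₂ + Y)))
      ≈⟨ solve 6 (λ A a₁ a₂ X₁ X₂ Y → let t = con 1 :+ (con 1 :+ con 0) in
           (con 0 :* (a₁ :* a₁) :+ (A :* (a₁ :* a₂) :+ a₁ :* X₁))
             :+ ((A :* (a₂ :* a₁) :+ (con 0 :* (a₂ :* a₂) :+ a₂ :* X₂)) :+ (a₁ :* X₁ :+ (a₂ :* X₂ :+ Y)))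
           := t :* (A :* (a₁ :* a₂)) :+ t :* (a₁ :* X₁) :+ t :* (a₂ :* X₂) :+ Y)
           ≈-refl A (a v₁) (a v₂) (X v₁) (X v₂) Y ⟩
    two * (A * (a v₁ * a v₂)) + two * (a v₁ * X v₁) + two * (a v₂ * X v₂) + Y ∎

  B≈ : B ≈ A * S + (X v₂ + - X v₁)
  B≈ = ≈-trans (sumFin-cong split) (≈-trans (sumFin-+ (λ j → A * a (J j)) (λ j → g v₂ j + - g v₁ j))
                 (+-cong (sumFin-*ˡ A (λ j → a (J j))) (≈-trans (sumFin-+ (g v₂) (λ j → - g v₁ j)) (+-congˡ (sumFin-neg (g v₁))))))
    where
    g : Fin (suc (suc m)) → Fin m → Carrier
    g u j = fromℕ (dist u (J j)) * a (J j)
    split : ∀ j → (fromℕ (dist v₁ v₂ N.+ dist v₂ (J j)) - fromℕ (dist v₁ (J j))) * a (J j) ≈ A * a (J j) + (g v₂ j + - g v₁ j)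
    split j = begin
      (fromℕ (dist v₁ v₂ N.+ dist v₂ (J j)) - fromℕ (dist v₁ (J j))) * a (J j)
        ≈⟨ *-congʳ (+-congʳ (fromℕ-+ (dist v₁ v₂) (dist v₂ (J j)))) ⟩
      ((A + fromℕ (dist v₂ (J j))) + - fromℕ (dist v₁ (J j))) * a (J j)
        ≈⟨ ≈-trans (distribʳ _ _ _) (+-cong (distribʳ _ _ _) (≈-sym (-‿distribˡ-* _ _))) ⟩
      (A * a (J j) + g v₂ j) + - g v₁ j
        ≈⟨ +-assoc _ _ _ ⟩
      A * a (J j) + (g v₂ j + - g v₁ j) ∎

  C₂≈ : C₂ ≈ two * X v₂ * S + - Y
  C₂≈ = ≈-trans (sumFin-cong row) (≈-trans (sumFin-+ (λ j → two * g j * S) (λ j → - Yrow j))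
                  (+-cong (≈-trans (sumFin-*ʳ S (λ j → two * g j)) (*-congʳ (sumFin-*ˡ two g))) (sumFin-neg Yrow)))
    where
    g : Fin m → Carrier
    g j = fromℕ (dist v₂ (J j)) * a (J j)
    Yterm : Fin m → Fin m → Carrier
    Yterm j k = fromℕ (dist (J j) (J k)) * (a (J j) * a (J k))
    Yrow : Fin m → Carrier
    Yrow j = sumFin (Yterm j)
    split : ∀ j k → (fromℕ (2 N.* dist v₂ (J j)) - fromℕ (dist (J j) (J k))) * (a (J j) * a (J k)) ≈ two * g j * a (J k) + - Yterm j k
    split j k = ≈-trans (distribʳ _ _ _) (+-cong
                  (≈-trans (*-congʳ (fromℕ-* 2 (dist v₂ (J j))))
                           (solve 4 (λ t q x y → (t :* q) :* (x :* y) := t :* (q :* x) :* y) ≈-refl _ _ _ _))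
                  (≈-sym (-‿distribˡ-* _ _)))
    row : ∀ j → sumFin (λ k → (fromℕ (2 N.* dist v₂ (J j)) - fromℕ (dist (J j) (J k))) * (a (J j) * a (J k))) ≈ two * g j * S + - Yrow j
    row j = ≈-trans (sumFin-cong (split j)) (≈-trans (sumFin-+ (λ k → two * g j * a (J k)) (λ k → - Yterm j k))
              (+-cong (sumFin-*ˡ (two * g j) (λ k → a (J k))) (sumFin-neg (Yterm j))))

  distanceForm+quadratic≈0 : sumFin a ≈ 0# → quadraticForm dist a + quadratic ≈ 0#
  distanceForm+quadratic≈0 Σa≈0 = begin
    quadraticForm dist a + quadratic
      ≈⟨ +-cong distanceForm-split (+-cong (+-congˡ (*-congˡ (*-congʳ B≈))) C₂≈) ⟩
    two * (A * (a v₁ * a v₂)) + two * (a v₁ * X v₁) + two * (a v₂ * X v₂) + Y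
      + (two * (A * (a v₁ * a v₁)) + two * ((A * S + (X v₂ + - X v₁)) * a v₁) + (two * X v₂ * S + - Y))
      ≈⟨ solve 9 (λ A a₁ a₂ S X₁ X₂ Y -X₁ -Y → let t = con 1 :+ (con 1 :+ con 0) in
           t :* (A :* (a₁ :* a₂)) :+ t :* (a₁ :* X₁) :+ t :* (a₂ :* X₂) :+ Y
             :+ (t :* (A :* (a₁ :* a₁)) :+ t :* ((A :* S :+ (X₂ :+ -X₁)) :* a₁) :+ (t :* X₂ :* S :+ -Y))
           := t :* (A :* a₁ :+ X₂) :* (a₁ :+ (a₂ :+ S)) :+ (t :* a₁ :* (X₁ :+ -X₁) :+ (Y :+ -Y)))
           ≈-refl A (a v₁) (a v₂) S (X v₁) (X v₂) Y (- X v₁) (- Y) ⟩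
    two * (A * a v₁ + X v₂) * sumFin a + (two * a v₁ * (X v₁ + - X v₁) + (Y + - Y))
      ≈⟨ +-cong (*-congˡ Σa≈0) (+-cong (*-congˡ (-‿inverseʳ (X v₁))) (-‿inverseʳ Y)) ⟩
    two * (A * a v₁ + X v₂) * 0# + (two * a v₁ * 0# + 0#)
      ≈⟨ ≈-trans (+-cong (zeroʳ _) (≈-trans (+-identityʳ _) (zeroʳ _))) (+-identityʳ 0#) ⟩
    0# ∎

  sumFin≈0 : a v₂ ≈ - (a v₁ + S) → sumFin a ≈ 0#
  sumFin≈0 a₂≈ = begin
    a v₁ + (a v₂ + S)              ≈⟨ +-congˡ (+-congʳ a₂≈) ⟩
    a v₁ + (- (a v₁ + S) + S)      ≈⟨ solve 3 (λ x s y → x :+ (y :+ s) := (x :+ s) :+ y) ≈-refl (a v₁) S (- (a v₁ + S)) ⟩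
    (a v₁ + S) + - (a v₁ + S)      ≈⟨ -‿inverseʳ (a v₁ + S) ⟩
    0#                             ∎

  distanceForm≈0 : sumFin a ≈ 0# → quadratic ≈ 0# → quadraticForm dist a ≈ 0#
  distanceForm≈0 Σa≈0 quadratic≈0 = begin
    quadraticForm dist a               ≈⟨ +-identityʳ _ ⟨
    quadraticForm dist a + 0#          ≈⟨ +-congˡ quadratic≈0 ⟨
    quadraticForm dist a + quadratic   ≈⟨ distanceForm+quadratic≈0 Σa≈0 ⟩
    0#                                 ∎

mainTheorem12 : ∀ {c ℓ} (K : CommutativeRing c ℓ)
    → RingDefs.IsField K → RingDefs.CharZero K
    → (m : ℕ) (T : Graph (suc (suc m))) → IsTree T
    → (d : Fin (suc (suc m)) → Fin (suc (suc m)) → Fin (suc (suc m)) → ℕ)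
    → (∀ u v w → IsSteinerDist T (u ∷ v ∷ w ∷ []) (d u v w))
    → (a : Fin (suc (suc m)) → CommutativeRing.Carrier K)
    → let open CommutativeRing K
          open RingDefs K
          v1 = fzero
          v2 = fsuc fzero
          J : Fin m → Fin (suc (suc m))
          J j = fsuc (fsuc j)
          dist : Fin (suc (suc m)) → Fin (suc (suc m)) → ℕ
          dist u v = d u v v
          A = fromℕ (dist v1 v2)
          B = sumFin (λ j → (fromℕ (dist v1 v2 N.+ dist v2 (J j)) - fromℕ (dist v1 (J j))) * a (J j))
          C2 = sumFin (λ j → sumFin (λ k →
                 (fromℕ (2 N.* dist v2 (J j)) - fromℕ (dist (J j) (J k))) * (a (J j) * a (J k))))
      in fromℕ 2 * (A * (a v1 * a v1)) + fromℕ 2 * (B * a v1) + C2 ≈ 0#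
       → a v2 ≈ - (a v1 + sumFin (λ j → a (J j)))
       → ∀ r → partialCubic d a r ≈ 0#
mainTheorem12 K isField charZero m T tree d steiner a quadratic≈0 a₂≈ r =
  *-cancelˡ-nonzero isField (charZero 1) (begin
    fromℕ 2 * partialCubic d a r  ≈⟨ partialCubic-doubled d a Σa≈0 steinerDist-halfPerimeter r ⟩
    Q + (Q + Q)                   ≈⟨ +-cong Q≈0 (+-cong Q≈0 Q≈0) ⟩
    0# + (0# + 0#)                ≈⟨ ≈-trans (+-identityˡ _) (+-identityˡ 0#) ⟩
    0#                            ∎)
  where
  open CommutativeRing K using (_≈_; _+_; _*_; 0#; +-cong; +-identityˡ; setoid) renaming (trans to ≈-trans)
  open RingDefs K using (fromℕ; partialCubic; sumFin)
  open FieldArithmetic K using (*-cancelˡ-nonzero)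
  open QuadraticForms K using (quadraticForm; partialCubic-doubled)
  open SteinerInTree T tree d steiner using (steinerDist-halfPerimeter; pairDist-sym; steinerDist-diagonal)
  open SplitAtFirstTwoVertices K d pairDist-sym steinerDist-diagonal a using (dist; sumFin≈0; distanceForm≈0)
  open import Relation.Binary.Reasoning.Setoid setoid
  Σa≈0 : sumFin a ≈ 0#
  Σa≈0 = sumFin≈0 a₂≈
  Q : CommutativeRing.Carrier K
  Q = quadraticForm dist a
  Q≈0 : Q ≈ 0#
  Q≈0 = distanceForm≈0 Σa≈0 quadratic≈0
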